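{- Let $\mathbf{C}$ be a chain in the Boolean lattice $\mathbf{B}_n$ such that at least one of $\varnothing$ and $[n]$ is not an element of $\mathbf{C}$. Then $\mathbf{B}_n-\mathbf{C}$ contains $\mathbf{B}_{n-1}$ as a subposet.
   Context: The Boolean lattice $\mathbf{B}_n$ is the poset $(2^{[n]},\subseteq)$ of all subsets of $[n]=\{1,\dots,n\}$. A chain is a set of pairwise comparable elements. $\mathbf{B}_n-\mathbf{C}$ is the set of subsets of $[n]$ not in $\mathbf{C}$ with the induced inclusion order. A poset $\mathbf{Q}$ contains a poset $\mathbf{P}$ as a subposet if there is an injection $\phi$ from $\mathbf{P}$ to $\mathbf{Q}$ with $x\le_{\mathbf{P}} y$ if and only if $\phi(x)\le_{\mathbf{Q}}\phi(y)$. -}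

module Defs where

open import Data.Nat using (ℕ; suc)
open import Data.Fin.Subset using (Subset; _⊆_; ⊥; ⊤)
open import Data.Sum using (_⊎_)
open import Data.Product using (_×_)
open import Function.Definitions using (Injective)
open import Relation.Binary.PropositionalEquality using (_≡_)
open import Relation.Nullary using (¬_)
open import Relation.Unary using (Pred; Decidable)
open import Level using (0ℓ)

-- The Boolean lattice B_n: elements are subsets of [n] (Subset n), ordered by _⊆_.

IsChain : {n : ℕ} → Pred (Subset n) 0ℓ → Set
IsChain {n} C = (x y : Subset n) → C x → C y → (x ⊆ y) ⊎ (y ⊆ x)

SubposetEmbedding : (m n : ℕ) → Pred (Subset n) 0ℓ → (Subset m → Subset n) → Set
SubposetEmbedding m n C φ =
  Injective _≡_ _≡_ φ
  × ((x : Subset m) → ¬ C (φ x))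
  × ((x y : Subset m) → (x ⊆ y → φ x ⊆ φ y) × (φ x ⊆ φ y → x ⊆ y))

{-# OPTIONS --safe #-}
-- If ∅ ∉ C, the least element of the chain C is nonempty, so some coordinate a
-- belongs to every member of C; then x ↦ x with a inserted as "absent" embeds
-- B_n into B_{n+1} avoiding C.  If [n+1] ∉ C, the same argument applied to the
-- complements of the members of C gives a coordinate a in no member of C, and
-- a is inserted as "present" instead.
module Submission where

open import Defs
open import Data.Nat using (ℕ; suc)
open import Data.Fin using (Fin; zero; punchIn; _≟_)
open import Data.Fin.Properties using (punchIn-punchOut)
open import Data.Fin.Subset
  using (Subset; Side; inside; outside; ⊥; ⊤; ∁; _⊆_; _∈_; _∉_)
open import Data.Fin.Subset.Properties
  using ( drop-∷-⊆; out⊆; in⊆in; anySubset?; nonempty?; Empty-unique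
        ; x∈∁p⇒x∉p; ∁p⊆∁q⇒p⊇q; ∪-∩-booleanAlgebra)
open import Data.Vec using ([]; _∷_; lookup; insertAt; removeAt; here)
open import Data.Vec.Properties
  using ([]=⇒lookup; lookup⇒[]=; insertAt-lookup; insertAt-punchIn; removeAt-insertAt)
import Algebra.Lattice.Properties.BooleanAlgebra as BooleanAlgebraProperties
open import Data.Sum using (_⊎_; inj₁; inj₂)
open import Data.Product using (Σ; ∃; _×_; _,_)
open import Function using (_∘_)
open import Relation.Nullary using (¬_; yes; no; contradiction)
open import Relation.Unary using (Pred; Decidable)
open import Relation.Binary.PropositionalEquality
  using (_≡_; _≢_; refl; sym; trans; cong; subst; module ≡-Reasoning)
open import Level using (0ℓ)

private
  variable
    n : ℕ

module _ {n : ℕ} where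
  open BooleanAlgebraProperties (∪-∩-booleanAlgebra n)

  ∁-involutive : (p : Subset n) → ∁ (∁ p) ≡ p
  ∁-involutive = ¬-involutive

  ∁⊥≡⊤ : ∁ ⊥ ≡ ⊤
  ∁⊥≡⊤ = ¬⊥≈⊤

IsChain-∷ : ∀ {C : Pred (Subset (suc n)) 0ℓ} (s : Side) → IsChain C → IsChain (C ∘ (s ∷_))
IsChain-∷ s chain x y Cx Cy with chain (s ∷ x) (s ∷ y) Cx Cy
... | inj₁ sx⊆sy = inj₁ (drop-∷-⊆ sx⊆sy)
... | inj₂ sy⊆sx = inj₂ (drop-∷-⊆ sy⊆sx)

IsChain-∁ : ∀ {C : Pred (Subset n) 0ℓ} → IsChain C → IsChain (C ∘ ∁)
IsChain-∁ chain x y Cx Cy with chain (∁ x) (∁ y) Cx Cy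
... | inj₁ ∁x⊆∁y = inj₂ (∁p⊆∁q⇒p⊇q ∁x⊆∁y)
... | inj₂ ∁y⊆∁x = inj₁ (∁p⊆∁q⇒p⊇q ∁y⊆∁x)

IsLeast : Pred (Subset n) 0ℓ → Subset n → Set
IsLeast C m = C m × (∀ c → C c → m ⊆ c)

least-element : ∀ {C : Pred (Subset n) 0ℓ} → Decidable C → IsChain C → ∃ C → ∃ (IsLeast C)
least-element {n = 0} _ _ ([] , C[]) = [] , C[] , λ { [] _ () }
least-element {n = suc n} {C} C? chain (p , Cp) with anySubset? (C? ∘ (outside ∷_))
... | yes ∃C₀ with least-element (C? ∘ (outside ∷_)) (IsChain-∷ outside chain) ∃C₀
...   | w , Cw , w-least = outside ∷ w , Cw , least
  where
  least : ∀ c → C c → outside ∷ w ⊆ c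
  least (outside ∷ t) Ct = out⊆ (w-least t Ct)
  least (inside ∷ t) Ct with chain (outside ∷ w) (inside ∷ t) Cw Ct
  ... | inj₁ ow⊆it = ow⊆it
  ... | inj₂ it⊆ow with it⊆ow here
  ...   | ()
least-element {n = suc n} C? chain (outside ∷ p , Cp) | no ∄C₀ = contradiction (p , Cp) ∄C₀
least-element {n = suc n} {C} C? chain (inside ∷ p , Cp) | no ∄C₀
  with least-element (C? ∘ (inside ∷_)) (IsChain-∷ inside chain) (p , Cp)
... | u , Cu , u-least = inside ∷ u , Cu , least
  where
  least : ∀ c → C c → inside ∷ u ⊆ c
  least (outside ∷ t) Ct = contradiction (t , Ct) ∄C₀
  least (inside ∷ t) Ct = in⊆in (u-least t Ct)

common-element : ∀ {C : Pred (Subset (suc n)) 0ℓ} → Decidable C → IsChain C → ¬ C ⊥ →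
                 ∃ λ a → ∀ c → C c → a ∈ c
common-element {C = C} C? chain ⊥∉C with anySubset? C?
... | no ∄C = zero , λ c Cc → contradiction (c , Cc) ∄C
... | yes ∃C with least-element C? chain ∃C
...   | m , Cm , m-least with nonempty? m
...     | yes (a , a∈m) = a , λ c Cc → m-least c Cc a∈m
...     | no m-empty = contradiction (subst C (Empty-unique m-empty) Cm) ⊥∉C

common-non-element : ∀ {C : Pred (Subset (suc n)) 0ℓ} → Decidable C → IsChain C → ¬ C ⊤ →
                     ∃ λ a → ∀ c → C c → a ∉ c
common-non-element {C = C} C? chain ⊤∉C
  with common-element (C? ∘ ∁) (IsChain-∁ chain) (⊤∉C ∘ subst C ∁⊥≡⊤)
... | a , a∈∁C = a , λ c Cc → x∈∁p⇒x∉p (a∈∁C (∁ c) (subst C (sym (∁-involutive c)) Cc))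

module _ {n : ℕ} (i : Fin (suc n)) (s : Side) where

  ∈⇒punchIn-∈-insertAt : ∀ {x : Subset n} {j} → j ∈ x → punchIn i j ∈ insertAt x i s
  ∈⇒punchIn-∈-insertAt {x} {j} j∈x =
    lookup⇒[]= _ _ (trans (insertAt-punchIn x i s j) ([]=⇒lookup j∈x))

  punchIn-∈-insertAt⇒∈ : ∀ {x : Subset n} {j} → punchIn i j ∈ insertAt x i s → j ∈ x
  punchIn-∈-insertAt⇒∈ {x} {j} j∈φx =
    lookup⇒[]= _ _ (trans (sym (insertAt-punchIn x i s j)) ([]=⇒lookup j∈φx))

  insertAt-mono-⊆ : ∀ {x y : Subset n} → x ⊆ y → insertAt x i s ⊆ insertAt y i s
  insertAt-mono-⊆ {x} {y} x⊆y {k} k∈φx with i ≟ k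
  ... | yes refl = lookup⇒[]= _ _ (begin
    lookup (insertAt y i s) i ≡⟨ insertAt-lookup y i s ⟩
    s                         ≡⟨ insertAt-lookup x i s ⟨
    lookup (insertAt x i s) i ≡⟨ []=⇒lookup k∈φx ⟩
    inside                    ∎)
    where open ≡-Reasoning
  ... | no i≢k = subst (_∈ insertAt y i s) (punchIn-punchOut i≢k)
    (∈⇒punchIn-∈-insertAt (x⊆y (punchIn-∈-insertAt⇒∈
      (subst (_∈ insertAt x i s) (sym (punchIn-punchOut i≢k)) k∈φx))))

  insertAt-cancel-⊆ : ∀ {x y : Subset n} → insertAt x i s ⊆ insertAt y i s → x ⊆ y
  insertAt-cancel-⊆ φx⊆φy j∈x = punchIn-∈-insertAt⇒∈ (φx⊆φy (∈⇒punchIn-∈-insertAt j∈x))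

  insertAt-injective : ∀ {x y : Subset n} → insertAt x i s ≡ insertAt y i s → x ≡ y
  insertAt-injective {x} {y} φx≡φy = begin
    x                            ≡⟨ removeAt-insertAt x i s ⟨
    removeAt (insertAt x i s) i  ≡⟨ cong (λ z → removeAt z i) φx≡φy ⟩
    removeAt (insertAt y i s) i  ≡⟨ removeAt-insertAt y i s ⟩
    y                            ∎
    where open ≡-Reasoning

  insertAt-subposetEmbedding : ∀ {C : Pred (Subset (suc n)) 0ℓ} → (∀ c → C c → lookup c i ≢ s) →
                               SubposetEmbedding n (suc n) C (λ x → insertAt x i s)
  insertAt-subposetEmbedding avoids =
    insertAt-injective ,
    (λ x Cφx → avoids _ Cφx (insertAt-lookup x i s)) ,
    λ x y → insertAt-mono-⊆ , insertAt-cancel-⊆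

lemma1 : (n : ℕ) (C : Pred (Subset (suc n)) 0ℓ) → Decidable C → IsChain C
    → (¬ C ⊥ ⊎ ¬ C ⊤)
    → Σ (Subset n → Subset (suc n)) (SubposetEmbedding n (suc n) C)
lemma1 n C C? chain (inj₁ ⊥∉C) with common-element C? chain ⊥∉C
... | a , a∈C = (λ x → insertAt x a outside) , insertAt-subposetEmbedding a outside
  λ c Cc c[a]≡outside → contradiction (trans (sym ([]=⇒lookup (a∈C c Cc))) c[a]≡outside) λ ()
lemma1 n C C? chain (inj₂ ⊤∉C) with common-non-element C? chain ⊤∉C
... | a , a∉C = (λ x → insertAt x a inside) , insertAt-subposetEmbedding a inside
  λ c Cc c[a]≡inside → a∉C c Cc (lookup⇒[]= a c c[a]≡inside)
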